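{- For all integers $j\geq 0$, $n\geq 0$ and $k\geq 1$, we have $O_{j,k}(n)=D_{j,k}(n)$, where $O_{j,k}(n)$ denotes the number of partitions of $n$ having exactly $j$ different part sizes that are divisible by $k$ (each such part size possibly repeated), and $D_{j,k}(n)$ denotes the number of partitions of $n$ having exactly $j$ different part sizes that each occur at least $k$ times.
   Context: A partition of a nonnegative integer $n$ is a finite weakly decreasing sequence of positive integers (its parts) summing to $n$; the empty partition is the unique partition of $0$. "Different part sizes" means distinct values among the parts. For $O_{j,k}(n)$ one counts the number of distinct values $v$ with $v\equiv 0\pmod{k}$ that occur as parts; for $D_{j,k}(n)$ one counts the number of distinct values $v$ that occur as a part with multiplicity at least $k$. -}

module Defs where

open import Data.Nat using (ℕ; zero; suc; _+_; _∸_; _≤_; _≤?_; _≟_; NonZero)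
open import Data.Nat.Divisibility using (_∣_; _∣?_)
open import Data.List using (List; []; _∷_; _++_; map; length; filter; deduplicate)
open import Relation.Nullary.Decidable using (Dec; yes; no; ⌊_⌋)
open import Relation.Binary.PropositionalEquality using (_≡_)

-- A partition is represented as the weakly decreasing list of its (positive) parts.
-- partitionsBounded fuel m n : all weakly decreasing lists of positive integers,
-- each ≤ m, summing to n (complete whenever fuel ≥ n).
partitionsBounded : ℕ → ℕ → ℕ → List (List ℕ)
partitionsBounded _ _ zero = [] ∷ []
partitionsBounded zero _ (suc _) = []
partitionsBounded (suc f) zero (suc n) = []
partitionsBounded (suc f) (suc m) (suc n) with suc m ≤? suc n
... | yes _ = partitionsBounded (suc f) m (suc n)
              ++ map (suc m ∷_) (partitionsBounded f (suc m) (suc n ∸ suc m))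
... | no _  = partitionsBounded (suc f) m (suc n)

partitions : ℕ → List (List ℕ)
partitions n = partitionsBounded n n n

partSizes : List ℕ → List ℕ
partSizes λ' = deduplicate _≟_ λ'

numSizesDivBy : ℕ → List ℕ → ℕ
numSizesDivBy k λ' = length (filter (λ v → k ∣? v) (partSizes λ'))

mult : ℕ → List ℕ → ℕ
mult v λ' = length (filter (λ x → x ≟ v) λ')

numSizesRepeated : ℕ → List ℕ → ℕ
numSizesRepeated k λ' = length (filter (λ v → k ≤? mult v λ') (partSizes λ'))

O : ℕ → ℕ → ℕ → ℕ
O j k n = length (filter (λ λ' → numSizesDivBy k λ' ≟ j) (partitions n))

D : ℕ → ℕ → ℕ → ℕ
D j k n = length (filter (λ λ' → numSizesRepeated k λ' ≟ j) (partitions n))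

module Submission where

-- Mark with z the part sizes counted by each statistic.  Sorting partitions by their
-- largest part M (and by how often it occurs) gives the products
--   Σ z^{#sizes k ∣ m} q^|λ| = ∏_{k ∤ m} 1/(1-q^m) · ∏_{k ∣ m} (1 + z q^m/(1-q^m)),
--   Σ z^{#sizes with ≥ k copies} q^|λ| = ∏_m (1 + q^m + … + q^((k-1)m) + z q^(km)/(1-q^m))
--                                     = ∏_m (1 + … + q^((k-1)m)) · ∏_m (1 + z q^(km)/(1-q^(km))).
-- The second factors are the same product, and the first factors agree by Glaisher's
-- identity, which follows from the z = 1 case of the same two factorisations by
-- cancelling ∏_{k ∣ m} 1/(1-q^m).
--
-- Products are truncated to part sizes ≤ n, which does not affect coefficients of q^n.

open import Defs
open import Data.Nat using (ℕ; zero; suc; _+_; _*_; _∸_; _≤_; _<_; z≤n; s≤s; _≤?_; _≟_)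
open import Data.Nat.Properties
open import Data.Nat.Divisibility using (_∣_; _∣?_; ∣m+n∣m⇒∣n; ∣⇒≤; m∣m*n)
open import Data.Bool using (if_then_else_)
open import Data.List using (List; []; _∷_; _++_; map; length; filter; deduplicate; replicate)
open import Data.List.Properties using (filter-all; filter-accept; filter-reject; filter-none; map-++; map-∘; map-cong; map-cong-local)
open import Data.Nat.ListAction using (sum)
open import Data.Nat.ListAction.Properties using (sum-++)
open import Data.List.Relation.Unary.All as All using (All; []; _∷_)
import Data.List.Relation.Unary.All.Properties as AllP
open import Data.Sum using (inj₁; inj₂)
open import Function using (_∘_)
open import Relation.Nullary using (Dec; yes; no; ¬_; does; contradiction)
open import Relation.Nullary.Decidable using (¬?)
open import Relation.Unary using (Decidable)
open import Relation.Binary.PropositionalEquality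

Series : Set
Series = ℕ → ℕ

infix 4 _≈_ _≈[_]_
infixl 6 _⊕_
infixl 7 _⊛_

_≈_ : Series → Series → Set
f ≈ g = ∀ n → f n ≡ g n

_≈[_]_ : Series → ℕ → Series → Set
f ≈[ n ] g = ∀ t → t ≤ n → f t ≡ g t

0ₛ : Series
0ₛ _ = 0

1ₛ : Series
1ₛ zero = 1
1ₛ (suc _) = 0

_⊕_ : Series → Series → Series
(f ⊕ g) n = f n + g n

shift : ℕ → Series → Series
shift zero f n = f n
shift (suc d) f zero = 0
shift (suc d) f (suc n) = shift d f n

_⊛_ : Series → Series → Series
(f ⊛ g) zero = f 0 * g 0
(f ⊛ g) (suc n) = f 0 * g (suc n) + ((f ∘ suc) ⊛ g) n

-- geometric e Y = Y / (1 - q^(1+e)), i.e. the sum of q^(i(1+e)) Y over all i.  At degree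
-- n it is computed from the first n+1 terms, which contain every contribution to that degree.
geometricUpTo : ℕ → Series → ℕ → Series
geometricUpTo e Y zero = Y
geometricUpTo e Y (suc f) = Y ⊕ shift (suc e) (geometricUpTo e Y f)

geometric : ℕ → Series → Series
geometric e Y n = geometricUpTo e Y n n

block : ℕ → ℕ → Series → Series
block M zero W = 0ₛ
block M (suc c) W = W ⊕ shift M (block M c W)

shift-cong : ∀ d {f g} → f ≈ g → shift d f ≈ shift d g
shift-cong zero f≈g n = f≈g n
shift-cong (suc d) f≈g zero = refl
shift-cong (suc d) f≈g (suc n) = shift-cong d f≈g n

shift-cong-below : ∀ e {f g} n → (∀ m → m < n → f m ≡ g m) → shift (suc e) f n ≡ shift (suc e) g n
shift-cong-below e zero f≡g = refl
shift-cong-below e (suc n) f≡g = go e n (λ m m≤n → f≡g m (s≤s m≤n))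
  where
  go : ∀ d {f g} n → (∀ m → m ≤ n → f m ≡ g m) → shift d f n ≡ shift d g n
  go zero n f≡g = f≡g n ≤-refl
  go (suc d) zero f≡g = refl
  go (suc d) (suc n) f≡g = go d n (λ m m≤n → f≡g m (m≤n⇒m≤1+n m≤n))

shift-⊕ : ∀ d f g → shift d (f ⊕ g) ≈ shift d f ⊕ shift d g
shift-⊕ zero f g n = refl
shift-⊕ (suc d) f g zero = refl
shift-⊕ (suc d) f g (suc n) = shift-⊕ d f g n

shift-shift : ∀ a b f → shift a (shift b f) ≈ shift (a + b) f
shift-shift zero b f n = refl
shift-shift (suc a) b f zero = refl
shift-shift (suc a) b f (suc n) = shift-shift a b f n

shift-below : ∀ d f n → n < d → shift d f n ≡ 0
shift-below (suc d) f zero _ = refl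
shift-below (suc d) f (suc n) (s≤s n<d) = shift-below d f n n<d

shift-above : ∀ d f n → d ≤ n → shift d f n ≡ f (n ∸ d)
shift-above zero f n _ = refl
shift-above (suc d) f (suc n) (s≤s d≤n) = shift-above d f n d≤n

shift-absorb : ∀ M c W X Y → (W ⊕ shift M (X ⊕ shift c Y)) ≈ (W ⊕ shift M X) ⊕ shift (M + c) Y
shift-absorb M c W X Y n = begin
    W n + shift M (X ⊕ shift c Y) n
  ≡⟨ cong (W n +_) (shift-⊕ M X (shift c Y) n) ⟩
    W n + (shift M X n + shift M (shift c Y) n)
  ≡⟨ cong (λ s → W n + (shift M X n + s)) (shift-shift M c Y n) ⟩
    W n + (shift M X n + shift (M + c) Y n)
  ≡⟨ sym (+-assoc (W n) _ _) ⟩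
    W n + shift M X n + shift (M + c) Y n ∎
  where open ≡-Reasoning

⊛-congˡ : ∀ {f f'} g → f ≈ f' → f ⊛ g ≈ f' ⊛ g
⊛-congˡ g f≈f' zero = cong (_* g 0) (f≈f' 0)
⊛-congˡ g f≈f' (suc n) = cong₂ _+_ (cong (_* g (suc n)) (f≈f' 0)) (⊛-congˡ g (f≈f' ∘ suc) n)

⊛-cong-upto : ∀ {f f' g g'} n → f ≈[ n ] f' → g ≈[ n ] g' → (f ⊛ g) n ≡ (f' ⊛ g') n
⊛-cong-upto zero f≈f' g≈g' = cong₂ _*_ (f≈f' 0 z≤n) (g≈g' 0 z≤n)
⊛-cong-upto (suc n) f≈f' g≈g' = cong₂ _+_
  (cong₂ _*_ (f≈f' 0 z≤n) (g≈g' (suc n) ≤-refl))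
  (⊛-cong-upto n (λ i i≤n → f≈f' (suc i) (s≤s i≤n)) (λ i i≤n → g≈g' i (m≤n⇒m≤1+n i≤n)))

⊛-sucʳ : ∀ f g n → (f ⊛ g) (suc n) ≡ (f ⊛ (g ∘ suc)) n + f (suc n) * g 0
⊛-sucʳ f g zero = refl
⊛-sucʳ f g (suc n) = begin
    f 0 * g (suc (suc n)) + ((f ∘ suc) ⊛ g) (suc n)
  ≡⟨ cong (f 0 * g (suc (suc n)) +_) (⊛-sucʳ (f ∘ suc) g n) ⟩
    f 0 * g (suc (suc n)) + (((f ∘ suc) ⊛ (g ∘ suc)) n + f (suc (suc n)) * g 0)
  ≡⟨ sym (+-assoc (f 0 * g (suc (suc n))) _ _) ⟩
    (f ⊛ (g ∘ suc)) (suc n) + f (suc (suc n)) * g 0 ∎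
  where open ≡-Reasoning

⊛-comm : ∀ f g → f ⊛ g ≈ g ⊛ f
⊛-comm f g zero = *-comm (f 0) (g 0)
⊛-comm f g (suc n) = begin
    f 0 * g (suc n) + ((f ∘ suc) ⊛ g) n
  ≡⟨ cong₂ _+_ (*-comm (f 0) (g (suc n))) (⊛-comm (f ∘ suc) g n) ⟩
    g (suc n) * f 0 + (g ⊛ (f ∘ suc)) n
  ≡⟨ +-comm (g (suc n) * f 0) _ ⟩
    (g ⊛ (f ∘ suc)) n + g (suc n) * f 0
  ≡⟨ sym (⊛-sucʳ g f n) ⟩
    (g ⊛ f) (suc n) ∎
  where open ≡-Reasoning

⊛-distribʳ : ∀ f f' g → (f ⊕ f') ⊛ g ≈ f ⊛ g ⊕ f' ⊛ g
⊛-distribʳ f f' g zero = *-distribʳ-+ (g 0) (f 0) (f' 0)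
⊛-distribʳ f f' g (suc n) = begin
    (f 0 + f' 0) * g (suc n) + ((f ∘ suc ⊕ f' ∘ suc) ⊛ g) n
  ≡⟨ cong₂ _+_ (*-distribʳ-+ (g (suc n)) (f 0) (f' 0)) (⊛-distribʳ (f ∘ suc) (f' ∘ suc) g n) ⟩
    (a + b) + (c + d)
  ≡⟨ +-assoc a b (c + d) ⟩
    a + (b + (c + d))
  ≡⟨ cong (a +_) (sym (+-assoc b c d)) ⟩
    a + ((b + c) + d)
  ≡⟨ cong (λ s → a + (s + d)) (+-comm b c) ⟩
    a + ((c + b) + d)
  ≡⟨ cong (a +_) (+-assoc c b d) ⟩
    a + (c + (b + d))
  ≡⟨ sym (+-assoc a c (b + d)) ⟩
    (a + c) + (b + d) ∎
  where
  open ≡-Reasoning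
  a b c d : ℕ
  a = f 0 * g (suc n)
  b = f' 0 * g (suc n)
  c = ((f ∘ suc) ⊛ g) n
  d = ((f' ∘ suc) ⊛ g) n

⊛-distribˡ : ∀ f g g' → f ⊛ (g ⊕ g') ≈ f ⊛ g ⊕ f ⊛ g'
⊛-distribˡ f g g' n = begin
    (f ⊛ (g ⊕ g')) n         ≡⟨ ⊛-comm f (g ⊕ g') n ⟩
    ((g ⊕ g') ⊛ f) n         ≡⟨ ⊛-distribʳ g g' f n ⟩
    (g ⊛ f) n + (g' ⊛ f) n   ≡⟨ cong₂ _+_ (⊛-comm g f n) (⊛-comm g' f n) ⟩
    (f ⊛ g) n + (f ⊛ g') n   ∎
  where open ≡-Reasoning

⊛-zeroˡ : ∀ g → 0ₛ ⊛ g ≈ 0ₛ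
⊛-zeroˡ g zero = refl
⊛-zeroˡ g (suc n) = ⊛-zeroˡ g n

⊛-zeroʳ : ∀ f → f ⊛ 0ₛ ≈ 0ₛ
⊛-zeroʳ f n = trans (⊛-comm f 0ₛ n) (⊛-zeroˡ f n)

⊛-identityˡ : ∀ g → 1ₛ ⊛ g ≈ g
⊛-identityˡ g zero = +-identityʳ (g 0)
⊛-identityˡ g (suc n) = begin
    (g (suc n) + 0) + (0ₛ ⊛ g) n   ≡⟨ cong₂ _+_ (+-identityʳ (g (suc n))) (⊛-zeroˡ g n) ⟩
    g (suc n) + 0                  ≡⟨ +-identityʳ _ ⟩
    g (suc n)                      ∎
  where open ≡-Reasoning

⊛-shiftˡ : ∀ d f g → shift d f ⊛ g ≈ shift d (f ⊛ g)
⊛-shiftˡ zero f g n = refl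
⊛-shiftˡ (suc d) f g zero = refl
⊛-shiftˡ (suc d) f g (suc n) = ⊛-shiftˡ d f g n

⊛-shiftʳ : ∀ d f g → f ⊛ shift d g ≈ shift d (f ⊛ g)
⊛-shiftʳ d f g n = trans (⊛-comm f (shift d g) n)
  (trans (⊛-shiftˡ d g f n) (shift-cong d (⊛-comm g f) n))

block-cong : ∀ M c {f g} → f ≈ g → block M c f ≈ block M c g
block-cong M zero f≈g n = refl
block-cong M (suc c) f≈g n = cong₂ _+_ (f≈g n) (shift-cong M (block-cong M c f≈g) n)

⊛-blockˡ : ∀ M c f g → block M c f ⊛ g ≈ block M c (f ⊛ g)
⊛-blockˡ M zero f g n = ⊛-zeroˡ g n
⊛-blockˡ M (suc c) f g n = trans (⊛-distribʳ f (shift M (block M c f)) g n)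
  (cong ((f ⊛ g) n +_) (trans (⊛-shiftˡ M (block M c f) g n) (shift-cong M (⊛-blockˡ M c f g) n)))

⊛-cancelʳ-upto : ∀ n f g h → h 0 ≡ 1 → (∀ t → t ≤ n → (f ⊛ h) t ≡ (g ⊛ h) t) → f ≈[ n ] g
⊛-cancelʳ-upto n f g h h₀≡1 fh≡gh t t≤n = agreeUpTo t t≤n t ≤-refl
  where
  -- comparing the coefficients of degree t+1: the leading terms f_(t+1), g_(t+1) appear
  -- multiplied by h 0 = 1 next to parts already known to agree
  cancelLast : ∀ a b c d → a + b * h 0 ≡ c + d * h 0 → a ≡ c → b ≡ d
  cancelLast a b c d eq refl = begin
      b       ≡⟨ sym (*-identityʳ b) ⟩
      b * 1   ≡⟨ cong (b *_) (sym h₀≡1) ⟩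
      b * h 0 ≡⟨ +-cancelˡ-≡ a _ _ eq ⟩
      d * h 0 ≡⟨ cong (d *_) h₀≡1 ⟩
      d * 1   ≡⟨ *-identityʳ d ⟩
      d       ∎
    where open ≡-Reasoning
  agreeUpTo : ∀ t → t ≤ n → f ≈[ t ] g
  agreeUpTo zero t≤n zero _ = cancelLast 0 (f 0) 0 (g 0) (fh≡gh 0 t≤n) refl
  agreeUpTo (suc t) t≤n i i≤t+1 with m≤n⇒m<n∨m≡n i≤t+1
  ... | inj₁ i<t = agreeUpTo t (≤-trans (n≤1+n t) t≤n) i (≤-pred i<t)
  ... | inj₂ refl = cancelLast _ (f (suc t)) _ (g (suc t))
    (trans (sym (⊛-sucʳ f h t)) (trans (fh≡gh (suc t) t≤n) (⊛-sucʳ g h t)))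
    (⊛-cong-upto t (agreeUpTo t (≤-trans (n≤1+n t) t≤n)) (λ _ _ → refl))

-- The one fact that matters is the functional equation
-- G = Y ⊕ q^(1+e) G together with its uniqueness (geometric-unique); every other
-- property of geometric is derived from these two.

geometricUpTo-enough : ∀ e Y f f' n → n ≤ f → n ≤ f' → geometricUpTo e Y f n ≡ geometricUpTo e Y f' n
geometricUpTo-enough e Y zero zero n _ _ = refl
geometricUpTo-enough e Y zero (suc f') zero _ _ = sym (+-identityʳ (Y 0))
geometricUpTo-enough e Y (suc f) zero zero _ _ = +-identityʳ (Y 0)
geometricUpTo-enough e Y (suc f) (suc f') n n≤f n≤f' = cong (Y n +_) (shift-cong-below e n (λ m m<n →
  geometricUpTo-enough e Y f f' m (≤-pred (≤-trans m<n n≤f)) (≤-pred (≤-trans m<n n≤f'))))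

geometric-eq : ∀ e Y → geometric e Y ≈ Y ⊕ shift (suc e) (geometric e Y)
geometric-eq e Y zero = sym (+-identityʳ (Y 0))
geometric-eq e Y (suc n) = cong (Y (suc n) +_) (shift-cong-below e (suc n) (λ m m<n →
  geometricUpTo-enough e Y n m m (≤-pred m<n) ≤-refl))

-- Uniqueness, in the form needed for counting: if a family F c (c ≥ c₀) satisfies
-- F c = Y ⊕ q^(1+e) F (c+1), then every F c is the geometric series of Y.
geometric-unique : ∀ e Y (F : ℕ → Series) c₀ →
  (∀ c → c₀ ≤ c → F c ≈ Y ⊕ shift (suc e) (F (suc c))) →
  ∀ c → c₀ ≤ c → F c ≈ geometric e Y
geometric-unique e Y F c₀ F-eq c c₀≤c n = atDegree n n ≤-refl c c₀≤c
  where
  atDegree : ∀ b m → m ≤ b → ∀ c → c₀ ≤ c → F c m ≡ geometric e Y m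
  atDegree b m m≤b c c₀≤c = begin
      F c m
    ≡⟨ F-eq c c₀≤c m ⟩
      Y m + shift (suc e) (F (suc c)) m
    ≡⟨ cong (Y m +_) (shift-cong-below e m (λ m' m'<m → below b m' m'<m m≤b)) ⟩
      Y m + shift (suc e) (geometric e Y) m
    ≡⟨ sym (geometric-eq e Y m) ⟩
      geometric e Y m ∎
    where
    open ≡-Reasoning
    below : ∀ b m' → m' < m → m ≤ b → F (suc c) m' ≡ geometric e Y m'
    below zero m' m'<m m≤b = contradiction (≤-trans m'<m m≤b) λ ()
    below (suc b) m' m'<m m≤b = atDegree b m' (≤-pred (≤-trans m'<m m≤b)) (suc c) (m≤n⇒m≤1+n c₀≤c)

geometric-unique₁ : ∀ e Y Z → Z ≈ Y ⊕ shift (suc e) Z → Z ≈ geometric e Y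
geometric-unique₁ e Y Z Z-eq = geometric-unique e Y (λ _ → Z) 0 (λ _ _ → Z-eq) 0 z≤n

geometric-cong : ∀ e {Y Y'} → Y ≈ Y' → geometric e Y ≈ geometric e Y'
geometric-cong e {Y} {Y'} Y≈Y' = geometric-unique₁ e Y' (geometric e Y)
  (λ n → trans (geometric-eq e Y n) (cong (_+ shift (suc e) (geometric e Y) n) (Y≈Y' n)))

⊛-geometricˡ : ∀ e f g → geometric e f ⊛ g ≈ geometric e (f ⊛ g)
⊛-geometricˡ e f g = geometric-unique₁ e (f ⊛ g) (geometric e f ⊛ g) (λ n →
  trans (⊛-congˡ g (geometric-eq e f) n) (trans (⊛-distribʳ f (shift (suc e) (geometric e f)) g n)
    (cong ((f ⊛ g) n +_) (⊛-shiftˡ (suc e) (geometric e f) g n))))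

⊛-geometricʳ : ∀ e f g → f ⊛ geometric e g ≈ geometric e (f ⊛ g)
⊛-geometricʳ e f g n = trans (⊛-comm f (geometric e g) n)
  (trans (⊛-geometricˡ e g f n) (geometric-cong e (⊛-comm g f) n))

geometric-split : ∀ e c Y → geometric e Y ≈ block (suc e) c Y ⊕ shift (c * suc e) (geometric e Y)
geometric-split e zero Y n = refl
geometric-split e (suc c) Y n = begin
    geometric e Y n
  ≡⟨ geometric-eq e Y n ⟩
    Y n + shift M (geometric e Y) n
  ≡⟨ cong (Y n +_) (shift-cong M (geometric-split e c Y) n) ⟩
    Y n + shift M (block M c Y ⊕ shift (c * M) (geometric e Y)) n
  ≡⟨ shift-absorb M (c * M) Y (block M c Y) (geometric e Y) n ⟩
    block M (suc c) Y n + shift (suc c * M) (geometric e Y) n ∎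
  where
  open ≡-Reasoning
  M : ℕ
  M = suc e

geometric-coarsen : ∀ m k' Y → geometric m Y ≈ geometric (m + k' * suc m) (block (suc m) (suc k') Y)
geometric-coarsen m k' Y = geometric-unique₁ (m + k' * suc m) (block (suc m) (suc k') Y) (geometric m Y)
  (geometric-split m (suc k') Y)

-- Two-variable series: the coefficient of z^j is a series in q.

BiSeries : Set
BiSeries = ℕ → Series

infix 4 _≋_
infixr 7 _⊙_

_≋_ : BiSeries → BiSeries → Set
X ≋ Y = ∀ j → X j ≈ Y j

_⊙_ : Series → BiSeries → BiSeries
(f ⊙ X) j = f ⊛ X j

⊛-factor : ∀ d e f X Y → f ⊛ X ⊕ shift d (geometric e (f ⊛ Y)) ≈ f ⊛ (X ⊕ shift d (geometric e Y))
⊛-factor d e f X Y n = begin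
    (f ⊛ X) n + shift d (geometric e (f ⊛ Y)) n
  ≡⟨ cong ((f ⊛ X) n +_) (shift-cong d (λ t → sym (⊛-geometricʳ e f Y t)) n) ⟩
    (f ⊛ X) n + shift d (f ⊛ geometric e Y) n
  ≡⟨ cong ((f ⊛ X) n +_) (sym (⊛-shiftʳ d f (geometric e Y) n)) ⟩
    (f ⊛ X) n + (f ⊛ shift d (geometric e Y)) n
  ≡⟨ sym (⊛-distribˡ f X (shift d (geometric e Y)) n) ⟩
    (f ⊛ (X ⊕ shift d (geometric e Y))) n ∎
  where open ≡-Reasoning

module Modulus (k' : ℕ) where

  k : ℕ
  k = suc k'

  nonMultProd : ℕ → Series
  nonMultProd zero = 1ₛ
  nonMultProd (suc m) with k ∣? suc m
  ... | yes _ = nonMultProd m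
  ... | no _ = geometric m (nonMultProd m)

  blockProd : ℕ → Series
  blockProd zero = 1ₛ
  blockProd (suc m) = block (suc m) k (blockProd m)

  k∤between : ∀ i L → suc i ≤ k' → ¬ (k ∣ (suc i + k * L))
  k∤between i L i<k' k∣ = <-irrefl refl (≤-trans k≤1+i i<k')
    where
    k≤1+i : k ≤ suc i
    k≤1+i = ∣⇒≤ (∣m+n∣m⇒∣n (subst (k ∣_) (+-comm (suc i) (k * L)) k∣) (m∣m*n L))

  -- The generating functions of both sides of the theorem, as products over the
  -- part sizes m ≤ M, in a setting where multiplication by the variable z that marks
  -- the counted part sizes is an abstract operation `mark`, commuting with series in q.
  -- Both factor as (a product over all sizes) × (a product over multiples of k).
  module Marked (mark : BiSeries → BiSeries)
                (mark-cong : ∀ {X Y} → X ≋ Y → mark X ≋ mark Y)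
                (mark-⊙ : ∀ f X → mark (f ⊙ X) ≋ f ⊙ mark X)
                (base : BiSeries) where

    gfO : ℕ → BiSeries
    gfO zero = base
    gfO (suc m) j with k ∣? suc m
    ... | yes _ = gfO m j ⊕ shift (suc m) (geometric m (mark (gfO m) j))
    ... | no _ = geometric m (gfO m j)

    gfD : ℕ → BiSeries
    gfD zero = base
    gfD (suc m) j = block (suc m) k (gfD m j) ⊕ shift (k * suc m) (geometric m (mark (gfD m) j))

    divProd : ℕ → BiSeries
    divProd zero = base
    divProd (suc m) j with k ∣? suc m
    ... | yes _ = divProd m j ⊕ shift (suc m) (geometric m (mark (divProd m) j))
    ... | no _ = divProd m j

    -- ∏_{l ≤ L} (1 + z q^(kl)/(1-q^(kl))): the same product, indexed by l = m/k.
    divProdᵏ : ℕ → BiSeries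
    divProdᵏ zero = base
    divProdᵏ (suc l) j = divProdᵏ l j ⊕ shift (k * suc l) (geometric (l + k' * suc l) (mark (divProdᵏ l) j))

    mark-factor : ∀ {X f Y} → X ≋ f ⊙ Y → mark X ≋ f ⊙ mark Y
    mark-factor {X} {f} {Y} X≋fY j n = trans (mark-cong X≋fY j n) (mark-⊙ f Y j n)

    gfO-factor : ∀ M → gfO M ≋ nonMultProd M ⊙ divProd M
    gfO-factor zero j n = sym (⊛-identityˡ (base j) n)
    gfO-factor (suc m) j n with k ∣? suc m
    ... | no _ = trans (geometric-cong m (gfO-factor m j) n)
                       (sym (⊛-geometricˡ m (nonMultProd m) (divProd m j) n))
    ... | yes _ = trans
      (cong₂ _+_ (gfO-factor m j n)
                 (shift-cong (suc m) (geometric-cong m (mark-factor (gfO-factor m) j)) n))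
      (⊛-factor (suc m) m (nonMultProd m) (divProd m j) (mark (divProd m) j) n)

    -- (1 + … + q^((k-1)m)) + z q^(km)/(1-q^m) = (1 + … + q^((k-1)m))(1 + z q^(km)/(1-q^(km))),
    -- using 1/(1-q^m) = (1 + … + q^((k-1)m))/(1-q^(km)).
    gfD-factor : ∀ M → gfD M ≋ blockProd M ⊙ divProdᵏ M
    gfD-factor zero j n = sym (⊛-identityˡ (base j) n)
    gfD-factor (suc m) j n = begin
        block M k (gfD m j) n + shift (k * M) (geometric m (mark (gfD m) j)) n
      ≡⟨ cong₂ _+_ (block-cong M k (gfD-factor m j) n)
                   (shift-cong (k * M) (geometric-cong m (mark-factor (gfD-factor m) j)) n) ⟩
        block M k (P ⊛ divProdᵏ m j) n + shift (k * M) (geometric m (P ⊛ mark (divProdᵏ m) j)) n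
      ≡⟨ cong₂ _+_ (sym (⊛-blockˡ M k P (divProdᵏ m j) n))
                   (shift-cong (k * M) (geometric-coarsen m k' _) n) ⟩
        (block M k P ⊛ divProdᵏ m j) n + shift (k * M) (geometric e (block M k (P ⊛ mark (divProdᵏ m) j))) n
      ≡⟨ cong ((block M k P ⊛ divProdᵏ m j) n +_) (shift-cong (k * M) (geometric-cong e
           (λ t → sym (⊛-blockˡ M k P (mark (divProdᵏ m) j) t))) n) ⟩
        (block M k P ⊛ divProdᵏ m j) n + shift (k * M) (geometric e (block M k P ⊛ mark (divProdᵏ m) j)) n
      ≡⟨ ⊛-factor (k * M) e (block M k P) (divProdᵏ m j) (mark (divProdᵏ m) j) n ⟩
        (blockProd M ⊛ divProdᵏ M j) n ∎
      where
      open ≡-Reasoning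
      M e : ℕ
      M = suc m
      e = m + k' * suc m
      P : Series
      P = blockProd m

    divProd-stable : ∀ M i j t → t ≤ M → divProd (i + M) j t ≡ divProd M j t
    divProd-stable M zero j t t≤M = refl
    divProd-stable M (suc i) j t t≤M with k ∣? suc (i + M)
    ... | no _ = divProd-stable M i j t t≤M
    ... | yes _ = begin
        divProd (i + M) j t + shift (suc (i + M)) _ t
      ≡⟨ cong (divProd (i + M) j t +_) (shift-below (suc (i + M)) _ t (s≤s (≤-trans t≤M (m≤n+m M i)))) ⟩
        divProd (i + M) j t + 0
      ≡⟨ +-identityʳ _ ⟩
        divProd (i + M) j t
      ≡⟨ divProd-stable M i j t t≤M ⟩
        divProd M j t ∎
      where open ≡-Reasoning

    divProd-reindex : ∀ {a b} → a ≡ b → divProd a ≋ divProd b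
    divProd-reindex refl j n = refl

    divProd-between : ∀ L i → i ≤ k' → divProd (i + k * L) ≋ divProd (k * L)
    divProd-between L zero i≤k' j n = refl
    divProd-between L (suc i) i≤k' j n with k ∣? suc (i + k * L)
    ... | yes k∣ = contradiction k∣ (k∤between i L i≤k')
    ... | no _ = divProd-between L i (≤-trans (n≤1+n i) i≤k') j n

    -- Both indexings of the product over multiples of k agree at the multiples of k …
    divProd-multiple : ∀ L → divProd (k * L) ≋ divProdᵏ L
    divProd-multiple zero j n = divProd-reindex (*-zeroʳ k) j n
    divProd-multiple (suc L) j n = trans (divProd-reindex (*-suc k L) j n) (nextMultiple n)
      where
      below≋ : divProd (k' + k * L) ≋ divProdᵏ L
      below≋ j' t = trans (divProd-between L k' ≤-refl j' t) (divProd-multiple L j' t)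
      nextMultiple : divProd (suc (k' + k * L)) j ≈ divProdᵏ (suc L) j
      nextMultiple n with k ∣? suc (k' + k * L)
      ... | no k∤ = contradiction (subst (k ∣_) (*-suc k L) (m∣m*n (suc L))) k∤
      ... | yes _ = cong₂ _+_ (below≋ j n)
          (trans (shift-cong (suc (k' + k * L)) (geometric-cong (k' + k * L) (mark-cong below≋ j)) n)
                 (cong (λ a → shift (suc a) (geometric a (mark (divProdᵏ L) j)) n)
                       (suc-injective (sym (*-suc k L)))))

    -- … and hence up to degree n at the bound n, since the factors for n < m ≤ kn are
    -- invisible there.
    divProd-upto : ∀ n j → divProd n j ≈[ n ] divProdᵏ n j
    divProd-upto n j t t≤n = begin
        divProd n j t                ≡⟨ sym (divProd-stable n (k' * n) j t t≤n) ⟩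
        divProd (k' * n + n) j t     ≡⟨ divProd-reindex (+-comm (k' * n) n) j t ⟩
        divProd (k * n) j t          ≡⟨ divProd-multiple n j t ⟩
        divProdᵏ n j t               ∎
      where open ≡-Reasoning

  -- With no marking (z = 1) both products are the generating function of all partitions
  -- into parts ≤ M, written in two ways.
  module Unmarked = Marked (λ X → X) (λ X≋Y → X≋Y) (λ f X j n → refl) (λ _ → 1ₛ)

  unmarked-gfO≋gfD : ∀ M → Unmarked.gfO M ≋ Unmarked.gfD M
  unmarked-gfO≋gfD zero j n = refl
  unmarked-gfO≋gfD (suc m) j n with k ∣? suc m
  ... | no _ = trans (geometric-cong m (unmarked-gfO≋gfD m j) n)
                     (geometric-split m k (Unmarked.gfD m j) n)
  ... | yes _ = trans (sym (geometric-eq m (Unmarked.gfO m j) n))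
                (trans (geometric-cong m (unmarked-gfO≋gfD m j) n)
                       (geometric-split m k (Unmarked.gfD m j) n))

  -- Glaisher's identity ∏_{k ∤ m} 1/(1-q^m) = ∏_m (1 + q^m + … + q^((k-1)m)), up to
  -- degree n: cancel the common factor ∏_{k ∣ m} 1/(1-q^m) from the two unmarked
  -- factorisations of the partition generating function.
  nonMultProd≈blockProd : ∀ n → nonMultProd n ≈[ n ] blockProd n
  nonMultProd≈blockProd n = ⊛-cancelʳ-upto n (nonMultProd n) (blockProd n) R constant-term
    (λ t t≤n → begin
      (nonMultProd n ⊛ R) t       ≡⟨ sym (Unmarked.gfO-factor n 0 t) ⟩
      Unmarked.gfO n 0 t          ≡⟨ unmarked-gfO≋gfD n 0 t ⟩
      Unmarked.gfD n 0 t          ≡⟨ Unmarked.gfD-factor n 0 t ⟩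
      (blockProd n ⊛ Rᵏ) t        ≡⟨ ⊛-cong-upto t (λ _ _ → refl)
                                      (λ i i≤t → sym (Unmarked.divProd-upto n 0 i (≤-trans i≤t t≤n))) ⟩
      (blockProd n ⊛ R) t         ∎)
    where
    open ≡-Reasoning
    R Rᵏ : Series
    R = Unmarked.divProd n 0
    Rᵏ = Unmarked.divProdᵏ n 0
    constant-term : R 0 ≡ 1
    constant-term = trans (cong (λ a → Unmarked.divProd a 0 0) (sym (+-identityʳ n)))
                          (Unmarked.divProd-stable 0 n 0 0 z≤n)

  module MarkedAgree (mark : BiSeries → BiSeries)
                     (mark-cong : ∀ {X Y} → X ≋ Y → mark X ≋ mark Y)
                     (mark-⊙ : ∀ f X → mark (f ⊙ X) ≋ f ⊙ mark X)
                     (base : BiSeries) where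
    open Marked mark mark-cong mark-⊙ base

    gfO≡gfD : ∀ n j → gfO n j n ≡ gfD n j n
    gfO≡gfD n j = begin
      gfO n j n                        ≡⟨ gfO-factor n j n ⟩
      (nonMultProd n ⊛ divProd n j) n  ≡⟨ ⊛-cong-upto n (nonMultProd≈blockProd n) (divProd-upto n j) ⟩
      (blockProd n ⊛ divProdᵏ n j) n   ≡⟨ sym (gfD-factor n j n) ⟩
      gfD n j n                        ∎
      where open ≡-Reasoning

-- indicator P? is 1 if P holds and 0 otherwise; it is defined through `does`, so that it
-- computes as soon as the verdict of the decision does.
indicator : ∀ {P : Set} → Dec P → ℕ
indicator P? = if does P? then 1 else 0

indicator-yes : ∀ {P : Set} (P? : Dec P) → P → indicator P? ≡ 1
indicator-yes (yes _) _ = refl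
indicator-yes (no ¬p) p = contradiction p ¬p

indicator-no : ∀ {P : Set} (P? : Dec P) → ¬ P → indicator P? ≡ 0
indicator-no (yes p) ¬p = contradiction p ¬p
indicator-no (no _) _ = refl

total : ∀ {A : Set} → (A → ℕ) → List A → ℕ
total f xs = sum (map f xs)

total-++ : ∀ {A : Set} (f : A → ℕ) xs ys → total f (xs ++ ys) ≡ total f xs + total f ys
total-++ f xs ys = trans (cong sum (map-++ f xs ys)) (sum-++ (map f xs) (map f ys))

total-map : ∀ {A B : Set} (f : B → ℕ) (g : A → B) xs → total f (map g xs) ≡ total (f ∘ g) xs
total-map f g xs = cong sum (sym (map-∘ xs))

total-cong : ∀ {A : Set} {P : A → Set} (f g : A → ℕ) {xs} → All P xs → (∀ {x} → P x → f x ≡ g x) →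
  total f xs ≡ total g xs
total-cong f g all f≡g = cong sum (map-cong-local (All.map f≡g all))

length-filter≡total : ∀ {A : Set} {P : A → Set} (P? : Decidable P) xs →
  length (filter P? xs) ≡ total (indicator ∘ P?) xs
length-filter≡total P? [] = refl
length-filter≡total P? (x ∷ xs) with P? x
... | yes _ = cong suc (length-filter≡total P? xs)
... | no _ = length-filter≡total P? xs

length-filter-∷ : ∀ {A : Set} {P : A → Set} (P? : Decidable P) x xs →
  length (filter P? (x ∷ xs)) ≡ indicator (P? x) + length (filter P? xs)
length-filter-∷ P? x xs with P? x
... | yes _ = refl
... | no _ = refl

partitionsInto : ℕ → ℕ → List (List ℕ)
partitionsInto m r = partitionsBounded r m r

partitionsBounded-fuel : ∀ f f' m n → n ≤ f → n ≤ f' → partitionsBounded f m n ≡ partitionsBounded f' m n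
partitionsBounded-fuel f f' m zero _ _ = refl
partitionsBounded-fuel (suc f) (suc f') zero (suc n) _ _ = refl
partitionsBounded-fuel (suc f) (suc f') (suc m) (suc n) n≤f n≤f' with suc m ≤? suc n
... | yes _ = cong₂ _++_ (partitionsBounded-fuel (suc f) (suc f') m (suc n) n≤f n≤f')
                (cong (map (suc m ∷_)) (partitionsBounded-fuel f f' (suc m) (n ∸ m)
                  (≤-trans (m∸n≤m n m) (≤-pred n≤f)) (≤-trans (m∸n≤m n m) (≤-pred n≤f'))))
... | no _ = partitionsBounded-fuel (suc f) (suc f') m (suc n) n≤f n≤f'

partitionsBounded-parts≤ : ∀ f m n → All (All (_≤ m)) (partitionsBounded f m n)
partitionsBounded-parts≤ f m zero = [] ∷ []
partitionsBounded-parts≤ zero m (suc n) = []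
partitionsBounded-parts≤ (suc f) zero (suc n) = []
partitionsBounded-parts≤ (suc f) (suc m) (suc n) with suc m ≤? suc n
... | yes _ = AllP.++⁺ (All.map (All.map m≤n⇒m≤1+n) (partitionsBounded-parts≤ (suc f) m (suc n)))
                       (AllP.map⁺ (All.map (≤-refl ∷_) (partitionsBounded-parts≤ f (suc m) (n ∸ m))))
... | no _ = All.map (All.map m≤n⇒m≤1+n) (partitionsBounded-parts≤ (suc f) m (suc n))

-- A partition into parts ≤ m+1 either has all parts ≤ m or starts with a part m+1
-- followed by a partition of r-(m+1) into parts ≤ m+1.
partitionsInto-suc : ∀ (w : List ℕ → ℕ) m r →
  total w (partitionsInto (suc m) r)
    ≡ total w (partitionsInto m r) + shift (suc m) (λ r' → total (w ∘ (suc m ∷_)) (partitionsInto (suc m) r')) r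
partitionsInto-suc w m zero = sym (+-identityʳ _)
partitionsInto-suc w m (suc n) with suc m ≤? suc n
... | yes m<n = begin
    total w (partitionsInto m (suc n) ++ map (suc m ∷_) (partitionsBounded n (suc m) (n ∸ m)))
  ≡⟨ total-++ w (partitionsInto m (suc n)) _ ⟩
    total w (partitionsInto m (suc n)) + total w (map (suc m ∷_) (partitionsBounded n (suc m) (n ∸ m)))
  ≡⟨ cong (total w (partitionsInto m (suc n)) +_) (begin
        total w (map (suc m ∷_) (partitionsBounded n (suc m) (n ∸ m)))
      ≡⟨ total-map w (suc m ∷_) (partitionsBounded n (suc m) (n ∸ m)) ⟩
        total (w ∘ (suc m ∷_)) (partitionsBounded n (suc m) (n ∸ m))
      ≡⟨ cong (total (w ∘ (suc m ∷_))) (partitionsBounded-fuel n (n ∸ m) (suc m) (n ∸ m) (m∸n≤m n m) ≤-refl) ⟩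
        total (w ∘ (suc m ∷_)) (partitionsInto (suc m) (n ∸ m))
      ≡⟨ sym (shift-above m _ n (≤-pred m<n)) ⟩
        shift m (λ r' → total (w ∘ (suc m ∷_)) (partitionsInto (suc m) r')) n ∎) ⟩
    total w (partitionsInto m (suc n)) + shift (suc m) (λ r' → total (w ∘ (suc m ∷_)) (partitionsInto (suc m) r')) (suc n) ∎
  where open ≡-Reasoning
... | no m≮n = trans (sym (+-identityʳ _)) (cong (total w (partitionsInto m (suc n)) +_)
    (sym (shift-below m _ n (≤-pred (≰⇒> m≮n)))))

dedup-fresh : ∀ M ρ → All (_< M) ρ → filter (¬? ∘ (M ≟_)) (deduplicate _≟_ ρ) ≡ deduplicate _≟_ ρ
dedup-fresh M ρ ρ<M = filter-all (¬? ∘ (M ≟_))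
  (All.map (λ y<M M≡y → <⇒≢ y<M (sym M≡y)) (AllP.deduplicate⁺ _≟_ ρ<M))

dedup-block : ∀ c M ρ → All (_< M) ρ → deduplicate _≟_ (replicate (suc c) M ++ ρ) ≡ M ∷ deduplicate _≟_ ρ
dedup-block zero M ρ ρ<M = cong (M ∷_) (dedup-fresh M ρ ρ<M)
dedup-block (suc c) M ρ ρ<M = cong (M ∷_) (begin
    filter (¬? ∘ (M ≟_)) (deduplicate _≟_ (replicate (suc c) M ++ ρ))
  ≡⟨ cong (filter (¬? ∘ (M ≟_))) (dedup-block c M ρ ρ<M) ⟩
    filter (¬? ∘ (M ≟_)) (M ∷ deduplicate _≟_ ρ)
  ≡⟨ filter-reject (¬? ∘ (M ≟_)) (λ M≢M → M≢M refl) ⟩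
    filter (¬? ∘ (M ≟_)) (deduplicate _≟_ ρ)
  ≡⟨ dedup-fresh M ρ ρ<M ⟩
    deduplicate _≟_ ρ ∎)
  where open ≡-Reasoning

mult-block : ∀ c M ρ → All (_< M) ρ → mult M (replicate c M ++ ρ) ≡ c
mult-block zero M ρ ρ<M = cong length (filter-none (_≟ M) (All.map <⇒≢ ρ<M))
mult-block (suc c) M ρ ρ<M = trans (cong length (filter-accept (_≟ M) refl)) (cong suc (mult-block c M ρ ρ<M))

mult-other : ∀ c M v ρ → v < M → mult v (replicate c M ++ ρ) ≡ mult v ρ
mult-other zero M v ρ v<M = refl
mult-other (suc c) M v ρ v<M =
  trans (cong length (filter-reject (_≟ v) (λ M≡v → <⇒≢ v<M (sym M≡v)))) (mult-other c M v ρ v<M)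

numSizesDivBy-block : ∀ k c M ρ → All (_< M) ρ →
  numSizesDivBy k (replicate (suc c) M ++ ρ) ≡ indicator (k ∣? M) + numSizesDivBy k ρ
numSizesDivBy-block k c M ρ ρ<M =
  trans (cong (length ∘ filter (k ∣?_)) (dedup-block c M ρ ρ<M)) (length-filter-∷ (k ∣?_) M _)

numSizesRepeated-block : ∀ k c M ρ → All (_< M) ρ →
  numSizesRepeated k (replicate (suc c) M ++ ρ) ≡ indicator (k ≤? suc c) + numSizesRepeated k ρ
numSizesRepeated-block k c M ρ ρ<M = begin
    length (filter (λ v → k ≤? mult v L) (deduplicate _≟_ L))
  ≡⟨ cong (length ∘ filter (λ v → k ≤? mult v L)) (dedup-block c M ρ ρ<M) ⟩
    length (filter (λ v → k ≤? mult v L) (M ∷ deduplicate _≟_ ρ))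
  ≡⟨ length-filter-∷ (λ v → k ≤? mult v L) M _ ⟩
    indicator (k ≤? mult M L) + length (filter (λ v → k ≤? mult v L) (deduplicate _≟_ ρ))
  ≡⟨ cong₂ _+_ (cong (indicator ∘ (k ≤?_)) (mult-block (suc c) M ρ ρ<M)) otherSizes ⟩
    indicator (k ≤? suc c) + numSizesRepeated k ρ ∎
  where
  open ≡-Reasoning
  L : List ℕ
  L = replicate (suc c) M ++ ρ
  otherSizes : length (filter (λ v → k ≤? mult v L) (deduplicate _≟_ ρ)) ≡ numSizesRepeated k ρ
  otherSizes = begin
      length (filter (λ v → k ≤? mult v L) (deduplicate _≟_ ρ))
    ≡⟨ length-filter≡total (λ v → k ≤? mult v L) (deduplicate _≟_ ρ) ⟩
      total (λ v → indicator (k ≤? mult v L)) (deduplicate _≟_ ρ)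
    ≡⟨ total-cong _ _ (AllP.deduplicate⁺ _≟_ ρ<M) (λ {v} v<M → cong (indicator ∘ (k ≤?_)) (mult-other (suc c) M v ρ v<M)) ⟩
      total (λ v → indicator (k ≤? mult v ρ)) (deduplicate _≟_ ρ)
    ≡⟨ sym (length-filter≡total (λ v → k ≤? mult v ρ) (deduplicate _≟_ ρ)) ⟩
      numSizesRepeated k ρ ∎

countGF : (List ℕ → ℕ) → ℕ → BiSeries
countGF st m j r = total (λ ρ → indicator (st ρ ≟ j)) (partitionsInto m r)

timesZ : BiSeries → BiSeries
timesZ X zero = 0ₛ
timesZ X (suc j) = X j

oneᶻ : BiSeries
oneᶻ zero = 1ₛ
oneᶻ (suc _) = 0ₛ

timesZ-cong : ∀ {X Y} → X ≋ Y → timesZ X ≋ timesZ Y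
timesZ-cong X≋Y zero n = refl
timesZ-cong X≋Y (suc j) n = X≋Y j n

timesZ-⊙ : ∀ f X → timesZ (f ⊙ X) ≋ f ⊙ timesZ X
timesZ-⊙ f X zero n = sym (⊛-zeroʳ f n)
timesZ-⊙ f X (suc j) n = refl

countGF-zero : ∀ st → st [] ≡ 0 → countGF st 0 ≋ oneᶻ
countGF-zero st st[]≡0 zero zero = cong (λ s → indicator (s ≟ 0) + 0) st[]≡0
countGF-zero st st[]≡0 (suc j) zero = cong (λ s → indicator (s ≟ suc j) + 0) st[]≡0
countGF-zero st st[]≡0 zero (suc r) = refl
countGF-zero st st[]≡0 (suc j) (suc r) = refl

countGF-suc : ∀ st m j → (λ r → total (λ ρ → indicator (suc (st ρ) ≟ j)) (partitionsInto m r)) ≈ timesZ (countGF st m) j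
countGF-suc st m zero r = nothing-counted (partitionsInto m r)
  where
  nothing-counted : ∀ ρs → total (λ ρ → indicator (suc (st ρ) ≟ 0)) ρs ≡ 0
  nothing-counted [] = refl
  nothing-counted (_ ∷ ρs) = nothing-counted ρs
countGF-suc st m (suc j) r = refl

-- Sorting partitions into parts ≤ M = m+1 by their number of parts M.
module Peel (st : List ℕ → ℕ) (j m : ℕ) where

  M : ℕ
  M = suc m

  weight : ℕ → List ℕ → ℕ
  weight c ρ = indicator (st (replicate c M ++ ρ) ≟ j)

  -- The partitions with at least c parts M (their first c parts M removed), …
  withBlock : ℕ → Series
  withBlock c r = total (weight c) (partitionsInto M r)

  -- … and those among them with exactly c parts M.
  exactBlock : ℕ → Series
  exactBlock c r = total (weight c) (partitionsInto m r)

  replicate-++-∷ : ∀ c ρ → replicate c M ++ (M ∷ ρ) ≡ replicate (suc c) M ++ ρ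
  replicate-++-∷ zero ρ = refl
  replicate-++-∷ (suc c) ρ = cong (M ∷_) (replicate-++-∷ c ρ)

  peel : ∀ c → withBlock c ≈ exactBlock c ⊕ shift M (withBlock (suc c))
  peel c r = trans (partitionsInto-suc (weight c) m r) (cong (exactBlock c r +_) (shift-cong M (λ r' →
    cong sum (map-cong (λ ρ → cong (indicator ∘ (_≟ j) ∘ st) (replicate-++-∷ c ρ)) (partitionsInto M r'))) r))

  peel-with : ∀ c {E} → exactBlock c ≈ E → withBlock c ≈ E ⊕ shift M (withBlock (suc c))
  peel-with c exact≈E t = trans (peel c t) (cong (_+ shift M (withBlock (suc c)) t) (exact≈E t))

  exactBlock-eval : ∀ c b → (∀ ρ → All (_< M) ρ → st (replicate c M ++ ρ) ≡ b + st ρ) →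
    exactBlock c ≈ (λ r → total (λ ρ → indicator (b + st ρ ≟ j)) (partitionsInto m r))
  exactBlock-eval c b st-block r = total-cong _ _ (All.map (All.map s≤s) (partitionsBounded-parts≤ r m r))
    (λ {ρ} ρ<M → cong (indicator ∘ (_≟ j)) (st-block ρ ρ<M))

  exactBlock-unchanged : ∀ c → (∀ ρ → All (_< M) ρ → st (replicate c M ++ ρ) ≡ st ρ) →
    exactBlock c ≈ countGF st m j
  exactBlock-unchanged c st-block = exactBlock-eval c 0 st-block

  exactBlock-counted : ∀ c → (∀ ρ → All (_< M) ρ → st (replicate c M ++ ρ) ≡ suc (st ρ)) →
    exactBlock c ≈ timesZ (countGF st m) j
  exactBlock-counted c st-block r = trans (exactBlock-eval c 1 st-block r) (countGF-suc st m j r)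

module Counting (k' : ℕ) where
  open Modulus k'
  open Marked timesZ timesZ-cong timesZ-⊙ oneᶻ

  statO statD : List ℕ → ℕ
  statO = numSizesDivBy k
  statD = numSizesRepeated k

  statO-block-k∤ : ∀ {M} → ¬ (k ∣ M) → ∀ c ρ → All (_< M) ρ → statO (replicate c M ++ ρ) ≡ statO ρ
  statO-block-k∤ k∤M zero ρ ρ<M = refl
  statO-block-k∤ {M} k∤M (suc c) ρ ρ<M =
    trans (numSizesDivBy-block k c M ρ ρ<M) (cong (_+ statO ρ) (indicator-no (k ∣? M) k∤M))

  statO-block-k∣ : ∀ {M} → k ∣ M → ∀ c ρ → All (_< M) ρ → statO (replicate (suc c) M ++ ρ) ≡ suc (statO ρ)
  statO-block-k∣ {M} k∣M c ρ ρ<M =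
    trans (numSizesDivBy-block k c M ρ ρ<M) (cong (_+ statO ρ) (indicator-yes (k ∣? M) k∣M))

  statD-block-few : ∀ {M} c → c < k → ∀ ρ → All (_< M) ρ → statD (replicate c M ++ ρ) ≡ statD ρ
  statD-block-few zero _ ρ ρ<M = refl
  statD-block-few {M} (suc c) c<k ρ ρ<M =
    trans (numSizesRepeated-block k c M ρ ρ<M) (cong (_+ statD ρ) (indicator-no (k ≤? suc c) (<⇒≱ c<k)))

  statD-block-many : ∀ {M} c → k ≤ suc c → ∀ ρ → All (_< M) ρ → statD (replicate (suc c) M ++ ρ) ≡ suc (statD ρ)
  statD-block-many {M} c k≤c ρ ρ<M =
    trans (numSizesRepeated-block k c M ρ ρ<M) (cong (_+ statD ρ) (indicator-yes (k ≤? suc c) k≤c))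

  countO≋gfO : ∀ m → countGF statO m ≋ gfO m
  countO≋gfO zero = countGF-zero statO refl
  countO≋gfO (suc m) j r with k ∣? suc m
  ... | no k∤M = trans (geometric-unique m (countGF statO m j) withBlock 0 anyBlock 0 z≤n r)
                       (geometric-cong m (countO≋gfO m j) r)
    where
    open Peel statO j m
    -- parts M are not counted: each copy contributes a factor 1/(1-q^M)
    anyBlock : ∀ c → 0 ≤ c → withBlock c ≈ countGF statO m j ⊕ shift M (withBlock (suc c))
    anyBlock c _ = peel-with c (exactBlock-unchanged c (statO-block-k∤ k∤M c))
  ... | yes k∣M = trans (peel 0 r) (cong₂ _+_ (countO≋gfO m j r)
      (shift-cong M (λ t → trans (geometric-unique m (timesZ (countGF statO m) j) withBlock 1 someBlock 1 ≤-refl t)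
                                 (geometric-cong m (timesZ-cong (countO≋gfO m) j) t)) r))
    where
    open Peel statO j m
    -- once a part M is present, the size M is counted once, whatever the number of copies
    someBlock : ∀ c → 1 ≤ c → withBlock c ≈ timesZ (countGF statO m) j ⊕ shift M (withBlock (suc c))
    someBlock (suc c) _ = peel-with (suc c) (exactBlock-counted (suc c) (statO-block-k∣ k∣M c))

  countD≋gfD : ∀ m → countGF statD m ≋ gfD m
  countD≋gfD zero = countGF-zero statD refl
  countD≋gfD (suc m) j r = trans (fewCopies k 0 refl r)
    (cong₂ _+_ (block-cong M k (countD≋gfD m j) r)
               (shift-cong (k * M) (geometric-cong m (timesZ-cong (countD≋gfD m) j)) r))
    where
    open Peel statD j m
    counted : Series
    counted = timesZ (countGF statD m) j
    -- with at least k copies of M, the size M is counted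
    manyCopies : ∀ c → k ≤ c → withBlock c ≈ counted ⊕ shift M (withBlock (suc c))
    manyCopies (suc c) k≤c = peel-with (suc c) (exactBlock-counted (suc c) (statD-block-many c k≤c))
    -- with c < k copies, the first k - c further copies leave it uncounted
    fewCopies : ∀ i c → c + i ≡ k → withBlock c ≈ block M i (countGF statD m j) ⊕ shift (i * M) (geometric m counted)
    fewCopies zero c c≡k = geometric-unique m counted withBlock k manyCopies c
      (subst (k ≤_) (trans (sym c≡k) (+-identityʳ c)) ≤-refl)
    fewCopies (suc i) c c+i≡k t = begin
        withBlock c t
      ≡⟨ peel-with c (exactBlock-unchanged c (statD-block-few c c<k)) t ⟩
        countGF statD m j t + shift M (withBlock (suc c)) t
      ≡⟨ cong (countGF statD m j t +_) (shift-cong M (fewCopies i (suc c) (trans (sym (+-suc c i)) c+i≡k)) t) ⟩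
        countGF statD m j t + shift M (block M i (countGF statD m j) ⊕ shift (i * M) (geometric m counted)) t
      ≡⟨ shift-absorb M (i * M) (countGF statD m j) (block M i (countGF statD m j)) (geometric m counted) t ⟩
        block M (suc i) (countGF statD m j) t + shift (suc i * M) (geometric m counted) t ∎
      where
      open ≡-Reasoning
      c<k : c < k
      c<k = subst (c <_) c+i≡k (m<m+n c (s≤s z≤n))

  open MarkedAgree timesZ timesZ-cong timesZ-⊙ oneᶻ using (gfO≡gfD)

  countO≡countD : ∀ n j → countGF statO n j n ≡ countGF statD n j n
  countO≡countD n j = begin
    countGF statO n j n   ≡⟨ countO≋gfO n j n ⟩
    gfO n j n             ≡⟨ gfO≡gfD n j ⟩
    gfD n j n             ≡⟨ sym (countD≋gfD n j n) ⟩
    countGF statD n j n   ∎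
    where open ≡-Reasoning

theorem1p4 : (j n k : ℕ) → 1 ≤ k → O j k n ≡ D j k n
theorem1p4 j n (suc k') (s≤s z≤n) = begin
    O j k n               ≡⟨ length-filter≡total (λ λ' → statO λ' ≟ j) (partitions n) ⟩
    countGF statO n j n   ≡⟨ countO≡countD n j ⟩
    countGF statD n j n   ≡⟨ sym (length-filter≡total (λ λ' → statD λ' ≟ j) (partitions n)) ⟩
    D j k n               ∎
  where
  open ≡-Reasoning
  open Counting k'
  k : ℕ
  k = suc k'
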